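{- Let $(p,p')$ be positive integers with $|p-p'|=1$ and $\alpha=\alpha_{(p,p')}$. If $X$ is a palindrome occurring as a factor of a Sturmian word, then $b\,\alpha(X)$ is a palindrome. Conversely, if $X$ is a palindrome such that $Xb$ is block-complete, then $\alpha^{ -1}(Xb)$ is a palindrome.
   Context: Words are over the alphabet $\{a,b\}$. A Sturmian word is a right-infinite aperiodic word over $\{a,b\}$ of minimal factor complexity. For positive integers $p,p'$ with $|p-p'|=1$, $\alpha_{(p,p')}$ is the morphism $a\mapsto a^pb$, $b\mapsto a^{p'}b$. A palindrome is a word equal to its reverse. A word is block-complete (for $\alpha$) if it is a concatenation of the blocks $a^pb$ and $a^{p'}b$; on block-complete words $W$, $\alpha^{ -1}(W)$ denotes the unique word $Z$ with $\alpha(Z)=W$. -}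

module Defs where

open import Data.Nat using (ℕ; zero; suc; _+_; _≤_; _<_)
open import Data.List using (List; []; _∷_; _++_; reverse; length; concatMap; replicate)
open import Data.List.Membership.Propositional using (_∈_)
open import Data.List.Relation.Unary.Unique.Propositional using (Unique)
open import Data.Product using (Σ; ∃; _×_)
open import Function.Bundles using (_⇔_)
open import Relation.Binary.PropositionalEquality using (_≡_)
open import Relation.Nullary using (¬_)

data Letter : Set where
  a b : Letter

Word : Set
Word = List Letter

InfWord : Set
InfWord = ℕ → Letter

Palindrome : Word → Set
Palindrome w = reverse w ≡ w

slice : InfWord → ℕ → ℕ → Word
slice s i zero    = []
slice s i (suc n) = s i ∷ slice s (suc i) n

Factor : InfWord → Word → Set
Factor s w = ∃ λ i → slice s i (length w) ≡ w

EventuallyPeriodic : InfWord → Set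
EventuallyPeriodic s = ∃ λ q → 0 < q × ∃ λ N → ∀ i → N ≤ i → s (i + q) ≡ s i

ComplexityIs : InfWord → ℕ → ℕ → Set
ComplexityIs s n k =
  Σ (List Word) λ L → Unique L × length L ≡ k ×
    (∀ w → (w ∈ L) ⇔ (length w ≡ n × Factor s w))

Sturmian : InfWord → Set
Sturmian s = ¬ EventuallyPeriodic s × (∀ n → ComplexityIs s n (suc n))

αimg : ℕ → ℕ → Letter → Word
αimg p p' a = replicate p a ++ b ∷ []
αimg p p' b = replicate p' a ++ b ∷ []

α : ℕ → ℕ → Word → Word
α p p' = concatMap (αimg p p')

-- Reversal turns α(Z), a product of blocks aᵏb, into the product of the blocks baᵏ in reverse
-- order, i.e. the image of reverse Z under the conjugate morphism a ↦ baᵖ, b ↦ baᵖ'; conjugating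
-- back by b gives reverse (b α(Z)) = b α(reverse Z) for every word Z.  So b α(X) is a palindrome
-- for every palindrome X, Sturmian factor or not.  Conversely, if α(Z) = Xb then b α(Z) = bXb is
-- a palindrome, so α(reverse Z) = α(Z), and α is injective because p ≢ p' makes {aᵖb, aᵖ'b} a code.
module Submission where

open import Defs
open import Data.Nat using (ℕ; suc; zero; _≤_)
open import Data.Nat.Properties using (1+n≢n)
open import Data.List using (List; _∷_; []; _++_; _∷ʳ_; reverse; replicate; concatMap)
open import Data.List.Properties
  using (++-assoc; ++-identityʳ; ++-conicalʳ; ∷-injectiveʳ; concatMap-++; unfold-reverse; reverse-++)
open import Data.Product using (∃; _×_; _,_)
open import Data.Sum using (_⊎_; inj₁; inj₂)
open import Relation.Binary.PropositionalEquality
open import Relation.Nullary using (contradiction)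
open import Function using (_∘′_)

private
  variable
    A B : Set

replicate-∷ʳ : ∀ n (x : A) → replicate n x ∷ʳ x ≡ x ∷ replicate n x
replicate-∷ʳ zero    x = refl
replicate-∷ʳ (suc n) x = cong (x ∷_) (replicate-∷ʳ n x)

reverse-replicate : ∀ n (x : A) → reverse (replicate n x) ≡ replicate n x
reverse-replicate zero    x = refl
reverse-replicate (suc n) x = begin
  reverse (x ∷ replicate n x)  ≡⟨ unfold-reverse x (replicate n x) ⟩
  reverse (replicate n x) ∷ʳ x ≡⟨ cong (_∷ʳ x) (reverse-replicate n x) ⟩
  replicate n x ∷ʳ x           ≡⟨ replicate-∷ʳ n x ⟩
  x ∷ replicate n x            ∎
  where open ≡-Reasoning

reverse-concatMap : ∀ (f : A → List B) xs →
                    reverse (concatMap f xs) ≡ concatMap (reverse ∘′ f) (reverse xs)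
reverse-concatMap f []       = refl
reverse-concatMap f (x ∷ xs) = begin
  reverse (f x ++ concatMap f xs)                         ≡⟨ reverse-++ (f x) (concatMap f xs) ⟩
  reverse (concatMap f xs) ++ reverse (f x)               ≡⟨ cong (_++ reverse (f x)) (reverse-concatMap f xs) ⟩
  concatMap (reverse ∘′ f) (reverse xs) ++ reverse (f x)  ≡⟨ cong (concatMap (reverse ∘′ f) (reverse xs) ++_) (++-identityʳ (reverse (f x))) ⟨
  concatMap (reverse ∘′ f) (reverse xs) ++ concatMap (reverse ∘′ f) (x ∷ [])
                                                          ≡⟨ concatMap-++ (reverse ∘′ f) (reverse xs) (x ∷ []) ⟨
  concatMap (reverse ∘′ f) (reverse xs ∷ʳ x)              ≡⟨ cong (concatMap (reverse ∘′ f)) (unfold-reverse x xs) ⟨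
  concatMap (reverse ∘′ f) (reverse (x ∷ xs))             ∎
  where open ≡-Reasoning

concatMap-conjugate : ∀ (u : List B) (f g : A → List B) → (∀ x → u ++ f x ≡ g x ++ u) →
                      ∀ xs → u ++ concatMap f xs ≡ concatMap g xs ++ u
concatMap-conjugate u f g uf≡gu []       = ++-identityʳ u
concatMap-conjugate u f g uf≡gu (x ∷ xs) = begin
  u ++ (f x ++ concatMap f xs)     ≡⟨ ++-assoc u (f x) (concatMap f xs) ⟨
  (u ++ f x) ++ concatMap f xs     ≡⟨ cong (_++ concatMap f xs) (uf≡gu x) ⟩
  (g x ++ u) ++ concatMap f xs     ≡⟨ ++-assoc (g x) u (concatMap f xs) ⟩
  g x ++ (u ++ concatMap f xs)     ≡⟨ cong (g x ++_) (concatMap-conjugate u f g uf≡gu xs) ⟩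
  g x ++ (concatMap g xs ++ u)     ≡⟨ ++-assoc (g x) (concatMap g xs) u ⟨
  (g x ++ concatMap g xs) ++ u     ∎
  where open ≡-Reasoning

palindrome-wrap : ∀ c {X : Word} → Palindrome X → Palindrome (c ∷ X ∷ʳ c)
palindrome-wrap c {X} pal = begin
  reverse (c ∷ X ∷ʳ c)     ≡⟨ unfold-reverse c (X ∷ʳ c) ⟩
  reverse (X ∷ʳ c) ∷ʳ c    ≡⟨ cong (_∷ʳ c) (reverse-++ X (c ∷ [])) ⟩
  (c ∷ reverse X) ∷ʳ c     ≡⟨ cong (λ Y → c ∷ Y ∷ʳ c) pal ⟩
  c ∷ X ∷ʳ c               ∎
  where open ≡-Reasoning

reverse-block : ∀ n → reverse (replicate n a ∷ʳ b) ≡ b ∷ replicate n a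
reverse-block n = begin
  reverse (replicate n a ∷ʳ b)     ≡⟨ reverse-++ (replicate n a) (b ∷ []) ⟩
  b ∷ reverse (replicate n a)      ≡⟨ cong (b ∷_) (reverse-replicate n a) ⟩
  b ∷ replicate n a                ∎
  where open ≡-Reasoning

block-cancel : ∀ m n {u v : Word} → replicate m a ++ b ∷ u ≡ replicate n a ++ b ∷ v →
               m ≡ n × u ≡ v
block-cancel zero    zero    e = refl , ∷-injectiveʳ e
block-cancel zero    (suc n) ()
block-cancel (suc m) zero    ()
block-cancel (suc m) (suc n) e with block-cancel m n (∷-injectiveʳ e)
... | refl , u≡v = refl , u≡v

module _ (p p' : ℕ) where

  exponent : Letter → ℕ
  exponent a = p
  exponent b = p'

  exponent-injective : p ≢ p' → ∀ {x y} → exponent x ≡ exponent y → x ≡ y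
  exponent-injective p≢p' {a} {a} _ = refl
  exponent-injective p≢p' {a} {b} e = contradiction e p≢p'
  exponent-injective p≢p' {b} {a} e = contradiction (sym e) p≢p'
  exponent-injective p≢p' {b} {b} _ = refl

  α-∷ : ∀ x w → α p p' (x ∷ w) ≡ replicate (exponent x) a ++ b ∷ α p p' w
  α-∷ a w = ++-assoc (replicate p a) (b ∷ []) (α p p' w)
  α-∷ b w = ++-assoc (replicate p' a) (b ∷ []) (α p p' w)

  α-injective : p ≢ p' → ∀ u v → α p p' u ≡ α p p' v → u ≡ v
  α-injective p≢p' []      []      _ = refl
  α-injective p≢p' []      (y ∷ v) e =
    contradiction (++-conicalʳ (replicate (exponent y) a) (b ∷ α p p' v) (sym (trans e (α-∷ y v)))) λ ()
  α-injective p≢p' (x ∷ u) []      e = sym (α-injective p≢p' [] (x ∷ u) (sym e))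
  α-injective p≢p' (x ∷ u) (y ∷ v) e
    with block-cancel (exponent x) (exponent y) (trans (sym (α-∷ x u)) (trans e (α-∷ y v)))
  ... | kx≡ky , αu≡αv = cong₂ _∷_ (exponent-injective p≢p' kx≡ky) (α-injective p≢p' u v αu≡αv)

  b∷αimg : ∀ x → b ∷ αimg p p' x ≡ reverse (αimg p p' x) ∷ʳ b
  b∷αimg a = sym (cong (_∷ʳ b) (reverse-block p))
  b∷αimg b = sym (cong (_∷ʳ b) (reverse-block p'))

  reverse-b∷α : ∀ Z → reverse (b ∷ α p p' Z) ≡ b ∷ α p p' (reverse Z)
  reverse-b∷α Z = begin
    reverse (b ∷ α p p' Z)                                  ≡⟨ unfold-reverse b (α p p' Z) ⟩
    reverse (α p p' Z) ∷ʳ b                                 ≡⟨ cong (_∷ʳ b) (reverse-concatMap (αimg p p') Z) ⟩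
    concatMap (reverse ∘′ αimg p p') (reverse Z) ∷ʳ b       ≡⟨ concatMap-conjugate (b ∷ []) (αimg p p') (reverse ∘′ αimg p p') b∷αimg (reverse Z) ⟨
    b ∷ α p p' (reverse Z)                                  ∎
    where open ≡-Reasoning

  palindrome-b∷α : ∀ {X} → Palindrome X → Palindrome (b ∷ α p p' X)
  palindrome-b∷α {X} pal = trans (reverse-b∷α X) (cong (λ Y → b ∷ α p p' Y) pal)

  palindrome-α⁻¹ : p ≢ p' → ∀ {X Z} → Palindrome X → α p p' Z ≡ X ∷ʳ b → Palindrome Z
  palindrome-α⁻¹ p≢p' {X} {Z} pal αZ≡Xb = α-injective p≢p' (reverse Z) Z (∷-injectiveʳ (begin
    b ∷ α p p' (reverse Z)   ≡⟨ reverse-b∷α Z ⟨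
    reverse (b ∷ α p p' Z)   ≡⟨ cong (λ Y → reverse (b ∷ Y)) αZ≡Xb ⟩
    reverse (b ∷ X ∷ʳ b)     ≡⟨ palindrome-wrap b pal ⟩
    b ∷ X ∷ʳ b               ≡⟨ cong (b ∷_) αZ≡Xb ⟨
    b ∷ α p p' Z             ∎))
    where open ≡-Reasoning

adjacent⇒≢ : ∀ {m n} → n ≡ suc m ⊎ m ≡ suc n → m ≢ n
adjacent⇒≢ (inj₁ refl) = 1+n≢n ∘′ sym
adjacent⇒≢ (inj₂ refl) = 1+n≢n

lemma1 : (p p' : ℕ) → 1 ≤ p → 1 ≤ p' → (p' ≡ suc p ⊎ p ≡ suc p') →
    ((X : Word) → Palindrome X → (∃ λ s → Sturmian s × Factor s X) →
      Palindrome (b ∷ α p p' X))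
    × ((X Z : Word) → Palindrome X → α p p' Z ≡ X ++ b ∷ [] → Palindrome Z)
lemma1 p p' _ _ adjacent =
  (λ X pal _ → palindrome-b∷α p p' pal) ,
  (λ X Z → palindrome-α⁻¹ p p' (adjacent⇒≢ adjacent))
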